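{- Let $\mathcal{G}$ be a hereditary graph class. The following are equivalent: (i) $\mathcal{G}$ has strongly sublinear separation-number; (ii) $\mathcal{G}$ has strongly sublinear tree-partition-width; (iii) $\mathcal{G}$ has strongly sublinear star-partition-width.
   Context: Graphs are simple and finite. A graph class is hereditary if it is closed under isomorphism and under taking induced subgraphs. A balanced separator in an $n$-vertex graph $G$ is a set $S\subseteq V(G)$ such that each component of $G-S$ has at most $n/2$ vertices; the separation-number $\mathrm{sep}(G)$ is the minimum size of a balanced separator. For graphs $H,G$, an $H$-partition of $G$ is a partition $(V_x:x\in V(H))$ of $V(G)$ indexed by $V(H)$ (parts may be empty) such that for every edge $vw\in E(G)$ with $v\in V_x$, $w\in V_y$, either $x=y$ or $xy\in E(H)$; its width is the maximum size of a part. The tree-partition-width $\mathrm{tpw}(G)$ is the minimum width of an $H$-partition of $G$ with $H$ a tree; the star-partition-width $\mathrm{spw}(G)$ is the minimum width of an $H$-partition of $G$ with $H$ a star. For a graph parameter $f$ and class $\mathcal{G}$, $f(\mathcal{G})$ denotes the function $n\mapsto\max\{f(G):G\in\mathcal{G},|V(G)|=n\}$, and $\mathcal{G}$ has strongly sublinear $f$ if $f(\mathcal{G})\in O(n^{1-\epsilon})$ for some fixed $\epsilon>0$. -}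

module Defs where

open import Data.Nat using (ℕ; zero; suc; _+_; _*_; _^_; _≤_; _<_; _≥_)
open import Data.Fin using (Fin; _≟_)
import Data.Fin as Fin
open import Data.Fin.Subset using (Subset; _∈_; _∉_; ∣_∣; ⊥)
open import Data.Bool using (Bool; true; false)
open import Data.Vec using (tabulate)
open import Data.List using (List; []; _∷_; length)
open import Data.List.Relation.Unary.Unique.Propositional using (Unique)
open import Data.Product using (Σ; ∃; _×_; _,_)
open import Data.Sum using (_⊎_)
open import Relation.Binary.PropositionalEquality using (_≡_)
open import Relation.Nullary.Decidable using (⌊_⌋)
open import Function.Definitions using (Injective)

record Graph (n : ℕ) : Set where
  field
    adj   : Fin n → Fin n → Bool
    sym   : ∀ x y → adj x y ≡ adj y x
    irrfl : ∀ x → adj x x ≡ false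
open Graph public

GraphClass : Set₁
GraphClass = ∀ {n} → Graph n → Set

-- Hereditary: closed under isomorphism and induced subgraphs, i.e. any
-- graph H isomorphic to an induced subgraph of a member G is a member.
Hereditary : GraphClass → Set
Hereditary 𝒢 = ∀ {n m} (G : Graph n) (H : Graph m) (f : Fin m → Fin n) →
  Injective _≡_ _≡_ f →
  (∀ x y → adj H x y ≡ adj G (f x) (f y)) →
  𝒢 G → 𝒢 H

data Reach {n} (G : Graph n) (S : Subset n) : Fin n → Fin n → Set where
  here : ∀ {v} → v ∉ S → Reach G S v v
  step : ∀ {u v w} → Reach G S u v → adj G v w ≡ true → w ∉ S → Reach G S u w

Connected : ∀ {n} → Graph n → Set
Connected G = ∀ x y → Reach G ⊥ x y

BalancedSeparator : ∀ {n} → Graph n → Subset n → Set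
BalancedSeparator {n} G S = ∀ v → v ∉ S → (C : Subset n) →
  (∀ w → (w ∈ C → Reach G S v w) × (Reach G S v w → w ∈ C)) →
  2 * ∣ C ∣ ≤ n

SepAtMost : ∀ {n} → Graph n → ℕ → Set
SepAtMost {n} G k = Σ (Subset n) λ S → BalancedSeparator G S × ∣ S ∣ ≤ k

data AdjChain {m} (H : Graph m) : List (Fin m) → Set where
  nil  : AdjChain H []
  one  : ∀ x → AdjChain H (x ∷ [])
  cons : ∀ x y zs → adj H x y ≡ true → AdjChain H (y ∷ zs) → AdjChain H (x ∷ y ∷ zs)

HasCycle : ∀ {m} → Graph m → Set
HasCycle {m} H = Σ (Fin m) λ x → Σ (List (Fin m)) λ ys → Σ (Fin m) λ z →
  Unique (x ∷ ys Data.List.++ (z ∷ [])) × 1 ≤ length ys ×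
  AdjChain H (x ∷ ys Data.List.++ (z ∷ [])) × adj H z x ≡ true

IsTree : ∀ {m} → Graph m → Set
IsTree {m} H = 1 ≤ m × Connected H × (HasCycle H → Data.Empty.⊥)
  where import Data.Empty

-- the star K_{1,s} on Fin (suc s), centre zero
starAdj : ∀ {s} → Fin (suc s) → Fin (suc s) → Bool
starAdj Fin.zero Fin.zero = false
starAdj Fin.zero (Fin.suc _) = true
starAdj (Fin.suc _) Fin.zero = true
starAdj (Fin.suc _) (Fin.suc _) = false

starSym : ∀ {s} (x y : Fin (suc s)) → starAdj x y ≡ starAdj y x
starSym Fin.zero Fin.zero = Relation.Binary.PropositionalEquality.refl
starSym Fin.zero (Fin.suc _) = Relation.Binary.PropositionalEquality.refl
starSym (Fin.suc _) Fin.zero = Relation.Binary.PropositionalEquality.refl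
starSym (Fin.suc _) (Fin.suc _) = Relation.Binary.PropositionalEquality.refl

starIrr : ∀ {s} (x : Fin (suc s)) → starAdj x x ≡ false
starIrr Fin.zero = Relation.Binary.PropositionalEquality.refl
starIrr (Fin.suc _) = Relation.Binary.PropositionalEquality.refl

Star : (s : ℕ) → Graph (suc s)
Star s = record { adj = starAdj ; sym = starSym ; irrfl = starIrr }

-- H-partitions (φ v = the index x with v ∈ V_x) and their width

IsHPartition : ∀ {n m} → Graph m → Graph n → (Fin n → Fin m) → Set
IsHPartition H G φ = ∀ v w → adj G v w ≡ true →
  (φ v ≡ φ w) ⊎ (adj H (φ v) (φ w) ≡ true)

part : ∀ {n m} → (Fin n → Fin m) → Fin m → Subset n
part φ x = tabulate λ v → ⌊ φ v ≟ x ⌋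

WidthAtMost : ∀ {n m} → (Fin n → Fin m) → ℕ → Set
WidthAtMost {m = m} φ k = ∀ (x : Fin m) → ∣ part φ x ∣ ≤ k

TpwAtMost : ∀ {n} → Graph n → ℕ → Set
TpwAtMost {n} G k = Σ ℕ λ m → Σ (Graph m) λ H → Σ (Fin n → Fin m) λ φ →
  IsTree H × IsHPartition H G φ × WidthAtMost φ k

SpwAtMost : ∀ {n} → Graph n → ℕ → Set
SpwAtMost {n} G k = Σ ℕ λ s → Σ (Fin n → Fin (suc s)) λ φ →
  IsHPartition (Star s) G φ × WidthAtMost φ k

-- Strongly sublinear: f(𝒢)(n) ∈ O(n^{1-ε}) for some ε > 0.
-- With ε = p/q (p,q > 0) and constant C = c^{1/q}, the bound
-- f ≤ C n^{1 - p/q} is equivalent to f^q · n^p ≤ c · n^q.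
-- `Param G k` means f(G) ≤ k (f is a minimum over witnesses).

StronglySublinear : GraphClass → (∀ {n} → Graph n → ℕ → Set) → Set
StronglySublinear 𝒢 Param = Σ ℕ λ c → Σ ℕ λ p → Σ ℕ λ q →
  1 ≤ p × 1 ≤ q × Σ ℕ λ N → ∀ n → N ≤ n → (G : Graph n) → 𝒢 G →
  Σ ℕ λ k → Param G k × (k ^ q) * (n ^ p) ≤ c * (n ^ q)

-- (iii) ⇒ (ii) because a star is a tree.
-- (ii) ⇒ (i): given a tree partition of width k, walk from any node of the tree towards a branch
-- carrying more than n/2 vertices of G. As the tree has no cycles this branch shrinks at every step,
-- so the walk stops at a node x all of whose branches carry at most n/2 vertices; then the part V_x
-- is a balanced separator of size at most k.
-- (i) ⇒ (iii): as the class is hereditary, every large induced subgraph G[P] has a balanced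
-- separator of size O(|P|^(1-p/q)). Splitting G recursively until all pieces have at most
-- W ≈ n^(1-1/(4q)) vertices takes O(log n) rounds and at most W separator vertices in total.
-- These form the centre of a star partition whose leaves are the pieces.

module Submission where

open import Defs renaming (sym to adj-sym)
open import Data.Bool using (true)
import Data.Bool as Bool
open import Data.Empty using (⊥; ⊥-elim)
open import Data.Fin using (Fin; zero; suc)
import Data.Fin as Fin
open import Data.Fin.Properties using (any?)
import Data.Fin.Properties as Fin
open import Data.Fin.Subset using (Subset; inside; outside; _∈_; _∉_; ∣_∣; _⊆_; _⊂_; _⊃_; ∁; _∪_; _─_; ⁅_⁆; ⊤)
  renaming (⊥ to ∅)
open import Data.Fin.Subset.Properties
open import Data.Fin.Subset.Induction using (⊂-wellFounded; ⊃-wellFounded; Acc; acc)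
open import Data.Nat using (ℕ; zero; suc; _+_; _*_; _^_; _≤_; _<_; _≤?_; _<?_; z≤n; s≤s; NonZero; >-nonZero)
open import Data.Nat.Properties
open import Data.Nat.Tactic.RingSolver using (solve-∀)
open import Data.Product using (Σ; ∃; _×_; _,_; proj₁; proj₂)
open import Data.Sum using (_⊎_; inj₁; inj₂)
open import Data.List using (List; []; _∷_; _++_; length)
open import Data.List.Relation.Unary.All using (All; []; _∷_)
import Data.List.Relation.Unary.All as All
open import Data.List.Relation.Unary.Any using (here; there)
open import Data.List.Membership.Propositional using () renaming (_∈_ to _∈ₗ_)
open import Data.List.Relation.Unary.All.Properties using (++⁻ʳ)
open import Data.List.Relation.Unary.AllPairs using ([]; _∷_)
open import Data.List.Relation.Unary.Unique.Propositional using (Unique)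
open import Data.Vec using ([]; _∷_; here; there; lookup; tabulate)
open import Data.Vec.Properties using (lookup∘tabulate; []=⇒lookup; lookup⇒[]=)
open import Data.Bool.Properties using (T-≡)
open import Function.Bundles using (Equivalence; _⇔_; mk⇔)
open import Function using (_∘_; id)
open import Relation.Binary.PropositionalEquality
  using (_≡_; _≢_; refl; sym; trans; cong; subst; module ≡-Reasoning)
open import Relation.Nullary using (¬_; Dec; yes; no; ¬?)
open import Relation.Nullary.Decidable using (_×-dec_; ⌊_⌋; toWitness; fromWitness)

x∈p─q⁻ : ∀ {n} (p q : Subset n) {x} → x ∈ p ─ q → x ∈ p × x ∉ q
x∈p─q⁻ (inside ∷ p) (outside ∷ q) here = here , λ ()
x∈p─q⁻ (outside ∷ p) (inside  ∷ q) {zero} ()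
x∈p─q⁻ (outside ∷ p) (outside ∷ q) {zero} ()
x∈p─q⁻ (_ ∷ p) (_ ∷ q) (there x∈p─q) with x∈p─q⁻ p q x∈p─q
... | x∈p , x∉q = there x∈p , x∉q ∘ drop-there

x∉p∪q⁻ : ∀ {n} {p q : Subset n} {x} → x ∉ p ∪ q → x ∉ p × x ∉ q
x∉p∪q⁻ x∉p∪q = x∉p∪q ∘ x∈p∪q⁺ ∘ inj₁ , x∉p∪q ∘ x∈p∪q⁺ ∘ inj₂

x∉p∪q⁺ : ∀ {n} {p q : Subset n} {x} → x ∉ p → x ∉ q → x ∉ p ∪ q
x∉p∪q⁺ {p = p} {q} x∉p x∉q x∈p∪q with x∈p∪q⁻ p q x∈p∪q
... | inj₁ x∈p = x∉p x∈p
... | inj₂ x∈q = x∉q x∈q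

∉∁p∪q⇒∈p : ∀ {n} {p q : Subset n} {x} → x ∉ ∁ p ∪ q → x ∈ p
∉∁p∪q⇒∈p = x∉∁p⇒x∈p ∘ proj₁ ∘ x∉p∪q⁻

∁⊤∪p⊆p : ∀ {n} (p : Subset n) → ∁ ⊤ ∪ p ⊆ p
∁⊤∪p⊆p p x∈ with x∈p∪q⁻ (∁ ⊤) p x∈
... | inj₁ x∈∁⊤ = ⊥-elim (x∈∁p⇒x∉p x∈∁⊤ ∈⊤)
... | inj₂ x∈p  = x∈p

∣p∪q∣≤∣p∣+∣q∣ : ∀ {n} (p q : Subset n) → ∣ p ∪ q ∣ ≤ ∣ p ∣ + ∣ q ∣
∣p∪q∣≤∣p∣+∣q∣ []            []            = z≤n
∣p∪q∣≤∣p∣+∣q∣ (inside  ∷ p) (s ∷ q)       =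
  s≤s (≤-trans (∣p∪q∣≤∣p∣+∣q∣ p q) (+-monoʳ-≤ ∣ p ∣ (∣p∣≤∣x∷p∣ s q)))
∣p∪q∣≤∣p∣+∣q∣ (outside ∷ p) (inside  ∷ q) =
  subst (suc ∣ p ∪ q ∣ ≤_) (sym (+-suc ∣ p ∣ ∣ q ∣)) (s≤s (∣p∪q∣≤∣p∣+∣q∣ p q))
∣p∪q∣≤∣p∣+∣q∣ (outside ∷ p) (outside ∷ q) = ∣p∪q∣≤∣p∣+∣q∣ p q

∣p∣+∣q∣≤n : ∀ {n} (p q : Subset n) → (∀ {x} → x ∈ p → x ∉ q) → ∣ p ∣ + ∣ q ∣ ≤ n
∣p∣+∣q∣≤n []            []            _        = z≤n
∣p∣+∣q∣≤n (inside  ∷ p) (inside  ∷ q) disjoint = ⊥-elim (disjoint here here)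
∣p∣+∣q∣≤n (inside  ∷ p) (outside ∷ q) disjoint =
  s≤s (∣p∣+∣q∣≤n p q λ x∈p x∈q → disjoint (there x∈p) (there x∈q))
∣p∣+∣q∣≤n {suc n} (outside ∷ p) (inside  ∷ q) disjoint =
  subst (_≤ suc n) (sym (+-suc ∣ p ∣ ∣ q ∣))
    (s≤s (∣p∣+∣q∣≤n p q λ x∈p x∈q → disjoint (there x∈p) (there x∈q)))
∣p∣+∣q∣≤n (outside ∷ p) (outside ∷ q) disjoint =
  m≤n⇒m≤1+n (∣p∣+∣q∣≤n p q λ x∈p x∈q → disjoint (there x∈p) (there x∈q))

∣p∣≡∣q∣+∣p─q∣ : ∀ {n} (p q : Subset n) → q ⊆ p → ∣ p ∣ ≡ ∣ q ∣ + ∣ p ─ q ∣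
∣p∣≡∣q∣+∣p─q∣ []            []            _   = refl
∣p∣≡∣q∣+∣p─q∣ (inside  ∷ p) (inside  ∷ q) q⊆p = cong suc (∣p∣≡∣q∣+∣p─q∣ p q (drop-∷-⊆ q⊆p))
∣p∣≡∣q∣+∣p─q∣ (inside  ∷ p) (outside ∷ q) q⊆p =
  trans (cong suc (∣p∣≡∣q∣+∣p─q∣ p q (drop-∷-⊆ q⊆p))) (sym (+-suc ∣ q ∣ ∣ p ─ q ∣))
∣p∣≡∣q∣+∣p─q∣ (outside ∷ p) (inside  ∷ q) q⊆p with q⊆p here
... | ()
∣p∣≡∣q∣+∣p─q∣ (outside ∷ p) (outside ∷ q) q⊆p = ∣p∣≡∣q∣+∣p─q∣ p q (drop-∷-⊆ q⊆p)

∁[p─q]≡∁p∪q : ∀ {n} (p q : Subset n) → ∁ (p ─ q) ≡ ∁ p ∪ q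
∁[p─q]≡∁p∪q []            []            = refl
∁[p─q]≡∁p∪q (inside  ∷ p) (inside  ∷ q) = cong (inside ∷_) (∁[p─q]≡∁p∪q p q)
∁[p─q]≡∁p∪q (inside  ∷ p) (outside ∷ q) = cong (outside ∷_) (∁[p─q]≡∁p∪q p q)
∁[p─q]≡∁p∪q (outside ∷ p) (inside  ∷ q) = cong (inside ∷_) (∁[p─q]≡∁p∪q p q)
∁[p─q]≡∁p∪q (outside ∷ p) (outside ∷ q) = cong (inside ∷_) (∁[p─q]≡∁p∪q p q)

-- Walks and components

module _ {n} {G : Graph n} {S : Subset n} where

  Reach-source : ∀ {u v} → Reach G S u v → u ∉ S
  Reach-source (here u∉S)   = u∉S
  Reach-source (step r _ _) = Reach-source r

  Reach-target : ∀ {u v} → Reach G S u v → v ∉ S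
  Reach-target (here v∉S)     = v∉S
  Reach-target (step _ _ v∉S) = v∉S

  Reach-trans : ∀ {u v w} → Reach G S u v → Reach G S v w → Reach G S u w
  Reach-trans r (here _)         = r
  Reach-trans r (step r′ a w∉S) = step (Reach-trans r r′) a w∉S

  Reach-sym : ∀ {u v} → Reach G S u v → Reach G S v u
  Reach-sym (here u∉S) = here u∉S
  Reach-sym {u} (step {v = v} {w} r a w∉S) =
    Reach-trans (step (here w∉S) (trans (adj-sym G w v) a) (Reach-target r)) (Reach-sym r)

Reach-within : ∀ {n} {G : Graph n} {B B′ R : Subset n} →
  (∀ {x y} → x ∈ R → adj G x y ≡ true → y ∉ B → y ∈ R) →
  (∀ {x} → x ∈ R → x ∉ B → x ∉ B′) →
  ∀ {u w} → u ∈ R → Reach G B u w → Reach G B′ u w × w ∈ R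
Reach-within closed avoid u∈R (here u∉B) = here (avoid u∈R u∉B) , u∈R
Reach-within closed avoid u∈R (step r a w∉B) with Reach-within closed avoid u∈R r
... | r′ , v∈R = let w∈R = closed v∈R a w∉B in step r′ a (avoid w∈R w∉B) , w∈R

IsComponent : ∀ {n} → Graph n → Subset n → Fin n → Subset n → Set
IsComponent G S v C = ∀ w → (w ∈ C → Reach G S v w) × (Reach G S v w → w ∈ C)

EveryComponent : (ℕ → Set) → ∀ {n} → Graph n → Subset n → Set
EveryComponent P {n} G S = ∀ v → v ∉ S → (C : Subset n) → IsComponent G S v C → P ∣ C ∣

EveryComponent-weaken : ∀ {P P′ : ℕ → Set} {n} {G : Graph n} {S} →
  (∀ {s} → P s → P′ s) → EveryComponent P G S → EveryComponent P′ G S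
EveryComponent-weaken f every v v∉S C isC = f (every v v∉S C isC)

module _ {n} {G : Graph n} {S : Subset n} {v C} (isC : IsComponent G S v C) where

  ∈-component⁻ : ∀ {w} → w ∈ C → Reach G S v w
  ∈-component⁻ = proj₁ (isC _)

  ∈-component⁺ : ∀ {w} → Reach G S v w → w ∈ C
  ∈-component⁺ = proj₂ (isC _)

  component-closed : ∀ {x y} → x ∈ C → adj G x y ≡ true → y ∉ S → y ∈ C
  component-closed x∈C a y∉S = ∈-component⁺ (step (∈-component⁻ x∈C) a y∉S)

  component-avoids : ∀ {x} → x ∈ C → x ∉ S
  component-avoids = Reach-target ∘ ∈-component⁻

module _ {n} (G : Graph n) (S : Subset n) where

  private
    Exit : Subset n → Fin n → Set
    Exit R u = ∃ λ w → adj G u w ≡ true × w ∉ S × w ∉ R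

    exit? : ∀ R u → Dec (Exit R u)
    exit? R u = any? λ w → (adj G u w Bool.≟ true) ×-dec ¬? (w ∈? S) ×-dec ¬? (w ∈? R)

  -- Grow a set of vertices reachable from v, one vertex at a time, until no edge of G − S leaves it.
  componentFrom : ∀ {v} R → Acc _⊃_ R → v ∈ R → (∀ {w} → w ∈ R → Reach G S v w) →
    ∃ (IsComponent G S v)
  componentFrom {v} R (acc rs) v∈R reach with any? (λ u → (u ∈? R) ×-dec exit? R u)
  ... | yes (u , u∈R , w , a , w∉S , w∉R) =
    componentFrom (R ∪ ⁅ w ⁆) (rs R⊂R∪w) (p⊆p∪q ⁅ w ⁆ v∈R) reach′
    where
    R⊂R∪w : R ⊂ R ∪ ⁅ w ⁆
    R⊂R∪w = p⊆p∪q ⁅ w ⁆ , w , q⊆p∪q R ⁅ w ⁆ (x∈⁅x⁆ w) , w∉R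
    reach′ : ∀ {w′} → w′ ∈ R ∪ ⁅ w ⁆ → Reach G S v w′
    reach′ w′∈ with x∈p∪q⁻ R ⁅ w ⁆ w′∈
    ... | inj₁ w′∈R = reach w′∈R
    ... | inj₂ w′∈w rewrite x∈⁅y⁆⇒x≡y w w′∈w = step (reach u∈R) a w∉S
  ... | no noExit = R , λ w → reach , complete
    where
    complete : ∀ {w} → Reach G S v w → w ∈ R
    complete (here _) = v∈R
    complete {w} (step {v = u} r a w∉S) with w ∈? R
    ... | yes w∈R = w∈R
    ... | no  w∉R = ⊥-elim (noExit (u , complete r , w , a , w∉S , w∉R))

  component : ∀ v → v ∉ S → ∃ (IsComponent G S v)
  component v v∉S = componentFrom ⁅ v ⁆ (⊃-wellFounded ⁅ v ⁆) (x∈⁅x⁆ v) λ {w} w∈v →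
    subst (Reach G S v) (sym (x∈⁅y⁆⇒x≡y v w∈v)) (here v∉S)

component-unique : ∀ {n} {G : Graph n} {S : Subset n} {v w C D} →
  IsComponent G S v C → IsComponent G S w D → Reach G S v w → C ≡ D
component-unique isC isD r = ⊆-antisym
  (λ x∈C → ∈-component⁺ isD (Reach-trans (Reach-sym r) (∈-component⁻ isC x∈C)))
  (λ x∈D → ∈-component⁺ isC (Reach-trans r (∈-component⁻ isD x∈D)))

componentSize-within : ∀ {n} {G : Graph n} {B B′ R : Subset n} {k} →
  (∀ {x y} → x ∈ R → adj G x y ≡ true → y ∉ B → y ∈ R) →
  (∀ {x} → x ∈ R → x ∉ B → x ∉ B′) →
  EveryComponent (_≤ k) G B′ →
  ∀ {v} → v ∈ R → v ∉ B → ∀ C → IsComponent G B v C → ∣ C ∣ ≤ k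
componentSize-within {G = G} {B′ = B′} closed avoid small {v} v∈R v∉B C isC
  with component G B′ v (avoid v∈R v∉B)
... | C′ , isC′ = ≤-trans (p⊆q⇒∣p∣≤∣q∣ C⊆C′) (small v (avoid v∈R v∉B) C′ isC′)
  where
  C⊆C′ : C ⊆ C′
  C⊆C′ w∈C = ∈-component⁺ isC′ (proj₁ (Reach-within closed avoid v∈R (∈-component⁻ isC w∈C)))

EveryComponent-antimono : ∀ {n} {G : Graph n} {B B′ : Subset n} {k} →
  B′ ⊆ B → EveryComponent (_≤ k) G B′ → EveryComponent (_≤ k) G B
EveryComponent-antimono B′⊆B small v v∉B =
  componentSize-within (λ _ _ _ → ∈⊤) (λ _ x∉B → x∉B ∘ B′⊆B) small ∈⊤ v∉B

-- Induced subgraphs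

member : ∀ {n} (p : Subset n) → Fin ∣ p ∣ → Fin n
member (inside  ∷ p) zero    = zero
member (inside  ∷ p) (suc i) = suc (member p i)
member (outside ∷ p) i       = suc (member p i)

member-∈ : ∀ {n} (p : Subset n) i → member p i ∈ p
member-∈ (inside  ∷ p) zero    = here
member-∈ (inside  ∷ p) (suc i) = there (member-∈ p i)
member-∈ (outside ∷ p) i       = there (member-∈ p i)

member-injective : ∀ {n} (p : Subset n) {i j} → member p i ≡ member p j → i ≡ j
member-injective (inside  ∷ p) {zero}  {zero}  _  = refl
member-injective (inside  ∷ p) {suc i} {suc j} eq = cong suc (member-injective p (Fin.suc-injective eq))
member-injective (outside ∷ p)                 eq = member-injective p (Fin.suc-injective eq)

member-surjective : ∀ {n} (p : Subset n) {x} → x ∈ p → ∃ λ i → member p i ≡ x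
member-surjective (inside ∷ p) here = zero , refl
member-surjective (s ∷ p) (there x∈p) with member-surjective p x∈p
member-surjective (inside  ∷ p) (there x∈p) | i , refl = suc i , refl
member-surjective (outside ∷ p) (there x∈p) | i , refl = i , refl

-- lift p t is the subset of p whose members are indexed by t
lift : ∀ {n} (p : Subset n) → Subset ∣ p ∣ → Subset n
lift []            []      = []
lift (inside  ∷ p) (s ∷ t) = s ∷ lift p t
lift (outside ∷ p) t       = outside ∷ lift p t

∣lift∣ : ∀ {n} (p : Subset n) t → ∣ lift p t ∣ ≡ ∣ t ∣
∣lift∣ []                  []            = refl
∣lift∣ (inside  ∷ p) (inside  ∷ t) = cong suc (∣lift∣ p t)
∣lift∣ (inside  ∷ p) (outside ∷ t) = ∣lift∣ p t
∣lift∣ (outside ∷ p) t             = ∣lift∣ p t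

member∈lift⁺ : ∀ {n} (p : Subset n) {t i} → i ∈ t → member p i ∈ lift p t
member∈lift⁺ (inside  ∷ p) here        = here
member∈lift⁺ (inside  ∷ p) (there i∈t) = there (member∈lift⁺ p i∈t)
member∈lift⁺ (outside ∷ p) i∈t         = there (member∈lift⁺ p i∈t)

member∈lift⁻ : ∀ {n} (p : Subset n) {t i} → member p i ∈ lift p t → i ∈ t
member∈lift⁻ (inside  ∷ p) {inside ∷ t} {zero}  here   = here
member∈lift⁻ (inside  ∷ p) {_ ∷ t}      {suc i} (there x∈) = there (member∈lift⁻ p x∈)
member∈lift⁻ (outside ∷ p)                      (there x∈) = member∈lift⁻ p x∈

-- restrict p C is C seen as a subset of the members of p
restrict : ∀ {n} (p : Subset n) → Subset n → Subset ∣ p ∣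
restrict []            []      = []
restrict (inside  ∷ p) (s ∷ C) = s ∷ restrict p C
restrict (outside ∷ p) (_ ∷ C) = restrict p C

∣restrict∣ : ∀ {n} (p C : Subset n) → C ⊆ p → ∣ restrict p C ∣ ≡ ∣ C ∣
∣restrict∣ []            []            _   = refl
∣restrict∣ (inside  ∷ p) (inside  ∷ C) C⊆p = cong suc (∣restrict∣ p C (drop-∷-⊆ C⊆p))
∣restrict∣ (inside  ∷ p) (outside ∷ C) C⊆p = ∣restrict∣ p C (drop-∷-⊆ C⊆p)
∣restrict∣ (outside ∷ p) (inside  ∷ C) C⊆p with C⊆p here
... | ()
∣restrict∣ (outside ∷ p) (outside ∷ C) C⊆p = ∣restrict∣ p C (drop-∷-⊆ C⊆p)

∈restrict⁺ : ∀ {n} (p C : Subset n) {i} → member p i ∈ C → i ∈ restrict p C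
∈restrict⁺ (inside  ∷ p) (inside ∷ C) {zero}  here       = here
∈restrict⁺ (inside  ∷ p) (_ ∷ C)      {suc i} (there x∈) = there (∈restrict⁺ p C x∈)
∈restrict⁺ (outside ∷ p) (_ ∷ C)              (there x∈) = ∈restrict⁺ p C x∈

∈restrict⁻ : ∀ {n} (p C : Subset n) {i} → i ∈ restrict p C → member p i ∈ C
∈restrict⁻ (inside  ∷ p) (inside ∷ C) {zero}  here       = here
∈restrict⁻ (inside  ∷ p) (_ ∷ C)      {suc i} (there i∈) = there (∈restrict⁻ p C i∈)
∈restrict⁻ (outside ∷ p) (_ ∷ C)              i∈         = there (∈restrict⁻ p C i∈)

induced : ∀ {n} → Graph n → (p : Subset n) → Graph ∣ p ∣
induced G p = record
  { adj   = λ i j → adj G (member p i) (member p j)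
  ; sym   = λ i j → adj-sym G (member p i) (member p j)
  ; irrfl = λ i → irrfl G (member p i)
  }

module _ {n} (G : Graph n) (P : Subset n) (S : Subset ∣ P ∣) where

  private
    B : Subset n
    B = ∁ P ∪ lift P S

    member∉B : ∀ {i} → i ∉ S → member P i ∉ B
    member∉B i∉S = x∉p∪q⁺ (x∈p⇒x∉∁p (member-∈ P _)) (i∉S ∘ member∈lift⁻ P)

    member∉B⁻ : ∀ {i} → member P i ∉ B → i ∉ S
    member∉B⁻ i∉B = proj₂ (x∉p∪q⁻ i∉B) ∘ member∈lift⁺ P

    lift-Reach : ∀ {i j} → Reach (induced G P) S i j → Reach G B (member P i) (member P j)
    lift-Reach (here i∉S)     = here (member∉B i∉S)
    lift-Reach (step r a j∉S) = step (lift-Reach r) a (member∉B j∉S)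

    restrict-Reach : ∀ {i x} → Reach G B (member P i) x →
      ∃ λ j → member P j ≡ x × Reach (induced G P) S i j
    restrict-Reach {i} (here i∉B) = i , refl , here (member∉B⁻ i∉B)
    restrict-Reach (step r a x∉B) with restrict-Reach r | member-surjective P (∉∁p∪q⇒∈p x∉B)
    ... | j , refl , r′ | k , refl = k , refl , step r′ a (member∉B⁻ x∉B)

    restrict-Reach′ : ∀ {i j} → Reach G B (member P i) (member P j) → Reach (induced G P) S i j
    restrict-Reach′ r with restrict-Reach r
    ... | j , eq , r′ rewrite member-injective P eq = r′

  lift-balanced : BalancedSeparator (induced G P) S →
    EveryComponent (λ s → 2 * s ≤ ∣ P ∣) G (∁ P ∪ lift P S)
  lift-balanced balanced v v∉B C isC with member-surjective P (∉∁p∪q⇒∈p v∉B)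
  ... | i , refl = subst (λ s → 2 * s ≤ ∣ P ∣) (∣restrict∣ P C C⊆P)
                     (balanced i (member∉B⁻ v∉B) (restrict P C) isC′)
    where
    C⊆P : C ⊆ P
    C⊆P = ∉∁p∪q⇒∈p ∘ component-avoids isC
    isC′ : IsComponent (induced G P) S i (restrict P C)
    isC′ j = (λ j∈ → restrict-Reach′ (∈-component⁻ isC (∈restrict⁻ P C j∈)))
           , (λ r → ∈restrict⁺ P C (∈-component⁺ isC (lift-Reach r)))

-- Cutting into small components

component-split : ∀ {n} {G : Graph n} {Q : Subset n} {v C} →
  v ∈ Q → IsComponent G (∁ Q) v C → Q ─ C ⊂ Q
component-split {Q = Q} {C = C} v∈Q isC =
  p─q⊆p Q C , _ , v∈Q , λ v∈Q─C → proj₂ (x∈p─q⁻ Q C v∈Q─C) (∈-component⁺ isC (here (x∈p⇒x∉∁p v∈Q)))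

EveryComponent-glue : ∀ {n} {G : Graph n} {Q : Subset n} {v C S S′} {k} → IsComponent G (∁ Q) v C →
  EveryComponent (_≤ k) G (∁ C ∪ S) → EveryComponent (_≤ k) G (∁ (Q ─ C) ∪ S′) →
  EveryComponent (_≤ k) G (∁ Q ∪ (S ∪ S′))
EveryComponent-glue {n} {G} {Q} {v} {C} {S} {S′} isC cutC cut′ u u∉B with u ∈? C
... | yes u∈C = componentSize-within closedC avoidC cutC u∈C u∉B
  where
  closedC : ∀ {x y} → x ∈ C → adj G x y ≡ true → y ∉ ∁ Q ∪ (S ∪ S′) → y ∈ C
  closedC x∈C a y∉B = component-closed isC x∈C a (proj₁ (x∉p∪q⁻ y∉B))
  avoidC : ∀ {x} → x ∈ C → x ∉ ∁ Q ∪ (S ∪ S′) → x ∉ ∁ C ∪ S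
  avoidC x∈C x∉B = x∉p∪q⁺ (x∈p⇒x∉∁p x∈C) (proj₁ (x∉p∪q⁻ (proj₂ (x∉p∪q⁻ x∉B))))
... | no u∉C = componentSize-within closed′ avoid′ cut′ (x∈p∧x∉q⇒x∈p─q (∉∁p∪q⇒∈p u∉B) u∉C) u∉B
  where
  closed′ : ∀ {x y} → x ∈ Q ─ C → adj G x y ≡ true → y ∉ ∁ Q ∪ (S ∪ S′) → y ∈ Q ─ C
  closed′ {x} {y} x∈Q─C a y∉B with x∈p─q⁻ Q C x∈Q─C
  ... | x∈Q , x∉C = x∈p∧x∉q⇒x∈p─q (∉∁p∪q⇒∈p y∉B) λ y∈C →
    x∉C (component-closed isC y∈C (trans (adj-sym G y x) a) (x∈p⇒x∉∁p x∈Q))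
  avoid′ : ∀ {x} → x ∈ Q ─ C → x ∉ ∁ Q ∪ (S ∪ S′) → x ∉ ∁ (Q ─ C) ∪ S′
  avoid′ x∈Q─C x∉B = x∉p∪q⁺ (x∈p⇒x∉∁p x∈Q─C) (proj₂ (x∉p∪q⁻ (proj₂ (x∉p∪q⁻ x∉B))))

-- Given a way to split any set of more than K vertices evenly at cost c/D per vertex,
-- sets whose components have at most 2^L vertices are cut into pieces of at most K
-- vertices at cost c·L/D per vertex.
module Separation {n} (G : Graph n) (K D c : ℕ) (K≥1 : 1 ≤ K)
  (split : ∀ P → K < ∣ P ∣ → ∃ λ S →
     D * ∣ S ∣ ≤ c * ∣ P ∣ × EveryComponent (λ s → 2 * s ≤ ∣ P ∣) G (∁ P ∪ S)) where

  Cut : ℕ → Subset n → Set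
  Cut L Q = ∃ λ S → D * ∣ S ∣ ≤ c * ∣ Q ∣ * L × EveryComponent (_≤ K) G (∁ Q ∪ S)

  private
    cost-∅ : ∀ m → D * ∣ ∅ {n} ∣ ≤ m
    cost-∅ m = subst (_≤ m) (sym (trans (cong (D *_) (∣⊥∣≡0 n)) (*-zeroʳ D))) z≤n

    cost-∪ : ∀ (S T : Subset n) → D * ∣ S ∪ T ∣ ≤ D * ∣ S ∣ + D * ∣ T ∣
    cost-∪ S T = ≤-trans (*-monoʳ-≤ D (∣p∪q∣≤∣p∣+∣q∣ S T)) (≤-reflexive (*-distribˡ-+ D ∣ S ∣ ∣ T ∣))

    cost-glue : ∀ (Q C S S′ : Subset n) L → C ⊆ Q →
      D * ∣ S ∣ ≤ c * ∣ C ∣ * L → D * ∣ S′ ∣ ≤ c * ∣ Q ─ C ∣ * L → D * ∣ S ∪ S′ ∣ ≤ c * ∣ Q ∣ * L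
    cost-glue Q C S S′ L C⊆Q costC cost′ = begin
      D * ∣ S ∪ S′ ∣                    ≤⟨ cost-∪ S S′ ⟩
      D * ∣ S ∣ + D * ∣ S′ ∣            ≤⟨ +-mono-≤ costC cost′ ⟩
      c * ∣ C ∣ * L + c * ∣ Q ─ C ∣ * L ≡⟨ sym (*-distribʳ-+ L (c * ∣ C ∣) (c * ∣ Q ─ C ∣)) ⟩
      (c * ∣ C ∣ + c * ∣ Q ─ C ∣) * L   ≡⟨ cong (_* L) (sym (*-distribˡ-+ c ∣ C ∣ ∣ Q ─ C ∣)) ⟩
      c * (∣ C ∣ + ∣ Q ─ C ∣) * L       ≡⟨ cong (λ s → c * s * L) (sym (∣p∣≡∣q∣+∣p─q∣ Q C C⊆Q)) ⟩
      c * ∣ Q ∣ * L                     ∎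
      where open ≤-Reasoning

    cost-split : ∀ (Q S₀ S₁ : Subset n) L →
      D * ∣ S₀ ∣ ≤ c * ∣ Q ∣ → D * ∣ S₁ ∣ ≤ c * ∣ Q ─ S₀ ∣ * L → D * ∣ S₀ ∪ S₁ ∣ ≤ c * ∣ Q ∣ * suc L
    cost-split Q S₀ S₁ L cost₀ cost₁ = begin
      D * ∣ S₀ ∪ S₁ ∣              ≤⟨ cost-∪ S₀ S₁ ⟩
      D * ∣ S₀ ∣ + D * ∣ S₁ ∣      ≤⟨ +-mono-≤ cost₀ cost₁ ⟩
      c * ∣ Q ∣ + c * ∣ Q ─ S₀ ∣ * L ≤⟨ +-monoʳ-≤ (c * ∣ Q ∣) (*-monoˡ-≤ L (*-monoʳ-≤ c (∣p─q∣≤∣p∣ Q S₀))) ⟩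
      c * ∣ Q ∣ + c * ∣ Q ∣ * L    ≡⟨ sym (*-suc (c * ∣ Q ∣) L) ⟩
      c * ∣ Q ∣ * suc L            ∎
      where open ≤-Reasoning

    halves-small : ∀ {Q S₀ : Subset n} L → ∣ Q ∣ ≤ 2 ^ suc L →
      EveryComponent (λ s → 2 * s ≤ ∣ Q ∣) G (∁ Q ∪ S₀) → EveryComponent (_≤ 2 ^ L) G (∁ (Q ─ S₀))
    halves-small {Q} {S₀} L Q≤2^1+L halves = subst (EveryComponent (_≤ 2 ^ L) G) (sym (∁[p─q]≡∁p∪q Q S₀))
      (EveryComponent-weaken (λ {s} 2s≤Q → *-cancelˡ-≤ {s} 2 (≤-trans 2s≤Q Q≤2^1+L)) halves)

  cutComponents : ∀ L → (∀ Q → ∣ Q ∣ ≤ 2 ^ L → Cut L Q) →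
    ∀ Q → Acc _⊂_ Q → EveryComponent (_≤ 2 ^ L) G (∁ Q) → Cut L Q
  cutComponents L cutSmall Q (acc rs) small with nonempty? Q
  ... | no empty = ∅ , cost-∅ _ , λ v v∉B → ⊥-elim (empty (v , ∉∁p∪q⇒∈p v∉B))
  ... | yes (v , v∈Q) with component G (∁ Q) v (x∈p⇒x∉∁p v∈Q)
  ... | C , isC with cutSmall C (small v (x∈p⇒x∉∁p v∈Q) C isC)
                   | cutComponents L cutSmall (Q ─ C) (rs (component-split v∈Q isC))
                       (EveryComponent-antimono (p⊆q⇒∁p⊇∁q (p─q⊆p Q C)) small)
  ... | S , costC , cutC | S′ , cost′ , cut′ =
    S ∪ S′ , cost-glue Q C S S′ L (x∉∁p⇒x∈p ∘ component-avoids isC) costC cost′ ,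
    EveryComponent-glue isC cutC cut′

  cutSmall : ∀ L Q → ∣ Q ∣ ≤ 2 ^ L → Cut L Q
  cutSmall L Q Q≤2^L with ∣ Q ∣ ≤? K
  ... | yes Q≤K = ∅ , cost-∅ _ , λ v v∉B C isC →
    ≤-trans (p⊆q⇒∣p∣≤∣q∣ (∉∁p∪q⇒∈p ∘ component-avoids isC)) Q≤K
  cutSmall zero Q Q≤1 | no Q≰K = ⊥-elim (Q≰K (≤-trans Q≤1 K≥1))
  cutSmall (suc L) Q Q≤2^1+L | no Q≰K with split Q (≰⇒> Q≰K)
  ... | S₀ , cost₀ , halves
      with cutComponents L (cutSmall L) (Q ─ S₀) (⊂-wellFounded _) (halves-small L Q≤2^1+L halves)
  ... | S₁ , cost₁ , cut₁ = S₀ ∪ S₁ , cost-split Q S₀ S₁ L cost₀ cost₁ ,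
    subst (EveryComponent (_≤ K) G) (trans (cong (_∪ S₁) (∁[p─q]≡∁p∪q Q S₀)) (∪-assoc (∁ Q) S₀ S₁)) cut₁

-- Star partitions

∈-part⁻ : ∀ {n m} (φ : Fin n → Fin m) {x v} → v ∈ part φ x → φ v ≡ x
∈-part⁻ φ {x} {v} v∈ = toWitness (Equivalence.from T-≡
  (trans (sym (lookup∘tabulate (λ w → ⌊ φ w Fin.≟ x ⌋) v)) ([]=⇒lookup v∈)))

∈-part⁺ : ∀ {n m} (φ : Fin n → Fin m) {x v} → φ v ≡ x → v ∈ part φ x
∈-part⁺ φ {x} {v} φv≡x = lookup⇒[]= v _
  (trans (lookup∘tabulate (λ w → ⌊ φ w Fin.≟ x ⌋) v) (Equivalence.to T-≡ (fromWitness φv≡x)))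

someMember : ∀ {n} → Subset n → Fin n → Fin n
someMember p d with nonempty? p
... | yes (x , _) = x
... | no  _       = d

someMember-∈ : ∀ {n} {p : Subset n} {x} d → x ∈ p → someMember p d ∈ p
someMember-∈ {p = p} d x∈p with nonempty? p
... | yes (_ , y∈p) = y∈p
... | no  empty     = ⊥-elim (empty (_ , x∈p))

someMember-default : ∀ {n} {p : Subset n} {x} d d′ → x ∈ p → someMember p d ≡ someMember p d′
someMember-default {p = p} d d′ x∈p with nonempty? p
... | yes _     = refl
... | no  empty = ⊥-elim (empty (_ , x∈p))

-- Centre S; every other vertex goes to the leaf named by a member of its component of G − S.
module StarPartition {n} (G : Graph n) (S : Subset n) where

  private
    componentOf : ∀ v → v ∉ S → Subset n
    componentOf v v∉S = proj₁ (component G S v v∉S)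

    isComponentOf : ∀ v v∉S → IsComponent G S v (componentOf v v∉S)
    isComponentOf v v∉S = proj₂ (component G S v v∉S)

    v∈componentOf : ∀ v v∉S → v ∈ componentOf v v∉S
    v∈componentOf v v∉S = ∈-component⁺ (isComponentOf v v∉S) (here v∉S)

  φ : Fin n → Fin (suc n)
  φ v with v ∈? S
  ... | yes _   = zero
  ... | no  v∉S = suc (someMember (componentOf v v∉S) v)

  φ-partition : IsHPartition (Star n) G φ
  φ-partition v w a with v ∈? S | w ∈? S
  ... | yes _   | yes _   = inj₁ refl
  ... | yes _   | no  _   = inj₂ refl
  ... | no  _   | yes _   = inj₂ refl
  ... | no  v∉S | no  w∉S = inj₁ (cong suc (begin
    someMember (componentOf v v∉S) v ≡⟨ cong (λ C → someMember C v) sameComponent ⟩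
    someMember (componentOf w w∉S) v ≡⟨ someMember-default v w (v∈componentOf w w∉S) ⟩
    someMember (componentOf w w∉S) w ∎))
    where
    open ≡-Reasoning
    sameComponent : componentOf v v∉S ≡ componentOf w w∉S
    sameComponent = component-unique (isComponentOf v v∉S) (isComponentOf w w∉S) (step (here v∉S) a w∉S)

  φ-zero : ∀ {v} → φ v ≡ zero → v ∈ S
  φ-zero {v} eq with v ∈? S
  ... | yes v∈S = v∈S

  φ-suc : ∀ {v y} → φ v ≡ suc y → Reach G S y v
  φ-suc {v} eq with v ∈? S
  φ-suc {v} refl | no v∉S = Reach-sym (∈-component⁻ (isComponentOf v v∉S) (someMember-∈ v (v∈componentOf v v∉S)))

  φ-width : ∀ {W} → ∣ S ∣ ≤ W → EveryComponent (_≤ W) G S → WidthAtMost φ W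
  φ-width S≤W small zero = ≤-trans (p⊆q⇒∣p∣≤∣q∣ (φ-zero ∘ ∈-part⁻ φ)) S≤W
  φ-width S≤W small (suc y) with y ∈? S
  ... | yes y∈S = subst (λ p → ∣ p ∣ ≤ _) (sym (Empty-unique λ (v , v∈) → Reach-source (φ-suc (∈-part⁻ φ v∈)) y∈S))
                    (subst (_≤ _) (sym (∣⊥∣≡0 n)) z≤n)
  ... | no  y∉S = ≤-trans (p⊆q⇒∣p∣≤∣q∣ (∈-component⁺ (isComponentOf y y∉S) ∘ φ-suc ∘ ∈-part⁻ φ))
                          (small y y∉S _ (isComponentOf y y∉S))

starPartition : ∀ {n} {G : Graph n} {S : Subset n} {W} →
  ∣ S ∣ ≤ W → EveryComponent (_≤ W) G S → SpwAtMost G W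
starPartition {n} {G} {S} S≤W small = n , φ , φ-partition , φ-width S≤W small
  where open StarPartition G S

^-distribʳ-* : ∀ m n o → (m * n) ^ o ≡ m ^ o * n ^ o
^-distribʳ-* m n zero    = refl
^-distribʳ-* m n (suc o) = begin
  m * n * (m * n) ^ o       ≡⟨ cong (m * n *_) (^-distribʳ-* m n o) ⟩
  m * n * (m ^ o * n ^ o)   ≡⟨ lemma m n (m ^ o) (n ^ o) ⟩
  m * m ^ o * (n * n ^ o)   ∎
  where
  open ≡-Reasoning
  lemma : ∀ m n x y → m * n * (x * y) ≡ m * x * (n * y)
  lemma = solve-∀

m≤m^n : ∀ {m} n → 1 ≤ m → 1 ≤ n → m ≤ m ^ n
m≤m^n {m} (suc n) 1≤m _ = begin
  m           ≡⟨ sym (*-identityʳ m) ⟩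
  m * 1       ≤⟨ *-monoʳ-≤ m (≤-trans (≤-reflexive (sym (^-zeroˡ n))) (^-monoˡ-≤ n 1≤m)) ⟩
  m * m ^ n   ∎
  where open ≤-Reasoning

^-cancelʳ-≤ : ∀ {m n} o → 1 ≤ o → m ^ o ≤ n ^ o → m ≤ n
^-cancelʳ-≤ {m} {n} o@(suc _) _ m^o≤n^o with m ≤? n
... | yes m≤n = m≤n
... | no  m≰n = ⊥-elim (<⇒≱ (^-monoˡ-< o (≰⇒> m≰n)) m^o≤n^o)

n<2^n : ∀ n → n < 2 ^ n
n<2^n zero    = s≤s z≤n
n<2^n (suc n) = begin-strict
  suc n           <⟨ s≤s (n<2^n n) ⟩
  suc (2 ^ n)     ≤⟨ +-monoˡ-≤ (2 ^ n) (m^n>0 2 n) ⟩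
  2 ^ n + 2 ^ n   ≡⟨ cong (2 ^ n +_) (sym (+-identityʳ (2 ^ n))) ⟩
  2 ^ suc n       ∎
  where open ≤-Reasoning

n*[1+n]≤2^n : ∀ n → 5 ≤ n → n * suc n ≤ 2 ^ n
n*[1+n]≤2^n n 5≤n with m≤n⇒∃[o]m+o≡n 5≤n
... | d , refl = go d
  where
  go : ∀ d → (5 + d) * (6 + d) ≤ 2 ^ (5 + d)
  go zero    = toWitness {a? = 30 ≤? 32} _
  go (suc d) = begin
    (6 + d) * (7 + d)               ≡⟨ expand d ⟩
    (5 + d) * (6 + d) + 2 * (6 + d) ≤⟨ +-monoʳ-≤ ((5 + d) * (6 + d)) (*-monoˡ-≤ (6 + d) {2} {5 + d} (s≤s (s≤s z≤n))) ⟩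
    (5 + d) * (6 + d) + (5 + d) * (6 + d)   ≤⟨ +-mono-≤ (go d) (go d) ⟩
    2 ^ (5 + d) + 2 ^ (5 + d)       ≡⟨ cong (2 ^ (5 + d) +_) (sym (+-identityʳ (2 ^ (5 + d)))) ⟩
    2 ^ (6 + d)                     ∎
    where
    open ≤-Reasoning
    expand : ∀ d → (6 + d) * (7 + d) ≡ (5 + d) * (6 + d) + 2 * (6 + d)
    expand = solve-∀

∃-log : ∀ b → 2 ≤ b → ∀ n → 1 ≤ n → ∃ λ a → b ^ a ≤ n × n < b ^ suc a
∃-log b 2≤b (suc zero) _ = zero , ≤-refl , ≤-trans 2≤b (≤-reflexive (sym (*-identityʳ b)))
∃-log b 2≤b (suc (suc n)) _ with ∃-log b 2≤b (suc n) (s≤s z≤n)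
... | a , lo , hi with b ^ suc a ≟ suc (suc n)
...   | no  b^1+a≢ = a , ≤-trans lo (n≤1+n _) , ≤∧≢⇒< hi (b^1+a≢ ∘ sym)
...   | yes b^1+a≡ = suc a , ≤-reflexive b^1+a≡ , (begin-strict
    suc (suc n)              ≡⟨ sym b^1+a≡ ⟩
    b ^ suc a                <⟨ m<m+n (b ^ suc a) (m^n>0 b {{>-nonZero (≤-trans (s≤s z≤n) 2≤b)}} (suc a)) ⟩
    b ^ suc a + b ^ suc a    ≡⟨ cong (b ^ suc a +_) (sym (+-identityʳ (b ^ suc a))) ⟩
    2 * b ^ suc a            ≤⟨ *-monoˡ-≤ (b ^ suc a) 2≤b ⟩
    b ^ suc (suc a)          ∎)
  where open ≤-Reasoning

T*k≤[1+c]*m : ∀ {c p q k m T} → 1 ≤ p → 1 ≤ q → 1 ≤ m → T ^ q ≤ m →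
  k ^ q * m ^ p ≤ c * m ^ q → T * k ≤ suc c * m
T*k≤[1+c]*m {c} {p} {q} {k} {m} {T} 1≤p 1≤q 1≤m T^q≤m bound = ^-cancelʳ-≤ q 1≤q (begin
  (T * k) ^ q         ≡⟨ ^-distribʳ-* T k q ⟩
  T ^ q * k ^ q       ≤⟨ *-monoˡ-≤ (k ^ q) (≤-trans T^q≤m (m≤m^n p 1≤m 1≤p)) ⟩
  m ^ p * k ^ q       ≡⟨ *-comm (m ^ p) (k ^ q) ⟩
  k ^ q * m ^ p       ≤⟨ bound ⟩
  c * m ^ q           ≤⟨ *-monoˡ-≤ (m ^ q) (≤-trans (n≤1+n c) (m≤m^n q (s≤s z≤n) 1≤q)) ⟩
  suc c ^ q * m ^ q   ≡⟨ sym (^-distribʳ-* (suc c) m q) ⟩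
  (suc c * m) ^ q     ∎)
  where open ≤-Reasoning

-- Sublinear separators yield sublinear star-partition-width

Bounded : GraphClass → (∀ {n} → Graph n → ℕ → Set) → (c p q N : ℕ) → Set
Bounded 𝒢 Param c p q N = ∀ n → N ≤ n → (G : Graph n) → 𝒢 G →
  Σ ℕ λ k → Param G k × (k ^ q) * (n ^ p) ≤ c * (n ^ q)

StronglySublinear-map : ∀ {𝒢 : GraphClass} {Param Param′ : ∀ {n} → Graph n → ℕ → Set} →
  (∀ {n} {G : Graph n} {k} → Param G k → Param′ G k) →
  StronglySublinear 𝒢 Param → StronglySublinear 𝒢 Param′
StronglySublinear-map f (c , p , q , 1≤p , 1≤q , N , bounded) =
  c , p , q , 1≤p , 1≤q , N , λ n N≤n G G∈𝒢 →
    let (k , param , bound) = bounded n N≤n G G∈𝒢 in k , f param , bound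

-- With n ≈ x^r (x = 2^a, r = 4q), every set of more than W = x^(r-1) vertices has a balanced
-- separator of at most (c+1)/T of its size, T = x². Halving down to pieces of at most W vertices
-- takes L ≈ r·a rounds and costs at most (c+1)·n·L/T ≤ W separator vertices.
module SeparatorsToStars (𝒢 : GraphClass) (hereditary : Hereditary 𝒢) (c p q′ N : ℕ) (1≤p : 1 ≤ p)
  (bounded : Bounded 𝒢 SepAtMost c p (suc q′) N) where

  q r b B a₀ : ℕ
  q  = suc q′
  r  = 4 * q
  b  = 2 ^ r
  B  = suc c * b * r
  a₀ = N + B + 5

  separateInduced : ∀ {n} (G : Graph n) → 𝒢 G → ∀ P → N ≤ ∣ P ∣ → ∃ λ S → Σ ℕ λ k →
    ∣ S ∣ ≤ k × k ^ q * ∣ P ∣ ^ p ≤ c * ∣ P ∣ ^ q × EveryComponent (λ s → 2 * s ≤ ∣ P ∣) G (∁ P ∪ S)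
  separateInduced G G∈𝒢 P N≤P
    with bounded ∣ P ∣ N≤P (induced G P) (hereditary G (induced G P) (member P) (member-injective P) (λ _ _ → refl) G∈𝒢)
  ... | k , (S , balanced , S≤k) , bound =
    lift P S , k , subst (_≤ k) (sym (∣lift∣ P S)) S≤k , bound , lift-balanced G P S balanced

  module Scale {n} (G : Graph n) (G∈𝒢 : 𝒢 G) (a : ℕ) (b^a≤n : b ^ a ≤ n) (n<b^1+a : n < b ^ suc a)
    (a₀≤a : a₀ ≤ a) where

    x W T L : ℕ
    x = 2 ^ a
    W = x ^ (3 + 4 * q′)
    T = x ^ 2
    L = r * suc a

    instance
      x≢0 : NonZero x
      x≢0 = m^n≢0 2 a

    1≤x : 1 ≤ x
    1≤x = m^n>0 2 a

    b^a≡x^r : b ^ a ≡ x ^ r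
    b^a≡x^r = trans (^-*-assoc 2 r a) (trans (cong (2 ^_) (*-comm r a)) (sym (^-*-assoc 2 a r)))

    n≤2^L : n ≤ 2 ^ L
    n≤2^L = ≤-trans (<⇒≤ n<b^1+a) (≤-reflexive (^-*-assoc 2 r (suc a)))

    n≤b*x^r : n ≤ b * x ^ r
    n≤b*x^r = ≤-trans (<⇒≤ n<b^1+a) (≤-reflexive (cong (b *_) b^a≡x^r))

    N≤W : N ≤ W
    N≤W = begin
      N      ≤⟨ ≤-trans (m≤m+n N B) (m≤m+n (N + B) 5) ⟩
      a₀     ≤⟨ a₀≤a ⟩
      a      ≤⟨ <⇒≤ (n<2^n a) ⟩
      x      ≤⟨ m≤m^n (3 + 4 * q′) 1≤x (s≤s z≤n) ⟩
      W      ∎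
      where open ≤-Reasoning

    T^q≤W : T ^ q ≤ W
    T^q≤W = ≤-trans (≤-reflexive (^-*-assoc x 2 q))
      (^-monoʳ-≤ x (subst (2 * q ≤_) (sym (exponents q′)) (m≤m+n (2 * q) (1 + 2 * q′))))
      where
      exponents : ∀ q′ → 3 + 4 * q′ ≡ 2 * suc q′ + (1 + 2 * q′)
      exponents = solve-∀

    cost≤T*W : suc c * n * L ≤ T * W
    cost≤T*W = begin
      suc c * n * L                   ≤⟨ *-monoˡ-≤ L (*-monoʳ-≤ (suc c) n≤b*x^r) ⟩
      suc c * (b * x ^ r) * (r * suc a) ≡⟨ regroup (suc c) b r (suc a) (x ^ r) ⟩
      x ^ r * (B * suc a)             ≤⟨ *-monoʳ-≤ (x ^ r) (≤-trans (*-monoˡ-≤ (suc a) B≤a) (n*[1+n]≤2^n a 5≤a)) ⟩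
      x ^ r * x                       ≡⟨ cong (x ^ r *_) (sym (*-identityʳ x)) ⟩
      x ^ r * x ^ 1                   ≡⟨ sym (^-distribˡ-+-* x r 1) ⟩
      x ^ (r + 1)                     ≡⟨ cong (x ^_) (exponents q′) ⟩
      x ^ (2 + (3 + 4 * q′))          ≡⟨ ^-distribˡ-+-* x 2 (3 + 4 * q′) ⟩
      T * W                           ∎
      where
      open ≤-Reasoning
      regroup : ∀ c b r a X → c * (b * X) * (r * a) ≡ X * (c * b * r * a)
      regroup = solve-∀
      exponents : ∀ q′ → 4 * suc q′ + 1 ≡ 2 + (3 + 4 * q′)
      exponents = solve-∀
      B≤a : B ≤ a
      B≤a = ≤-trans (≤-trans (m≤n+m B N) (m≤m+n (N + B) 5)) a₀≤a
      5≤a : 5 ≤ a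
      5≤a = ≤-trans (m≤n+m 5 (N + B)) a₀≤a

    split : ∀ P → W < ∣ P ∣ → ∃ λ S →
      T * ∣ S ∣ ≤ suc c * ∣ P ∣ × EveryComponent (λ s → 2 * s ≤ ∣ P ∣) G (∁ P ∪ S)
    split P W<P with separateInduced G G∈𝒢 P (≤-trans N≤W (<⇒≤ W<P))
    ... | S , k , S≤k , bound , halves = S , ≤-trans (*-monoʳ-≤ T S≤k)
      (T*k≤[1+c]*m {c} {p} {q} {k} {∣ P ∣} {T} 1≤p (s≤s z≤n) (≤-trans (s≤s z≤n) W<P)
        (≤-trans T^q≤W (<⇒≤ W<P)) bound) , halves

    open Separation G W T (suc c) (m^n>0 x (3 + 4 * q′)) split using (Cut; cutSmall)

    spw : SpwAtMost G W
    spw = starPartition S≤W (EveryComponent-antimono (∁⊤∪p⊆p S) (proj₂ (proj₂ cut)))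
      where
      cut : Cut L ⊤
      cut = cutSmall L ⊤ (subst (_≤ 2 ^ L) (sym (∣⊤∣≡n n)) n≤2^L)
      S : Subset n
      S = proj₁ cut
      S≤W : ∣ S ∣ ≤ W
      S≤W = *-cancelˡ-≤ T {{m^n≢0 x 2}}
        (≤-trans (proj₁ (proj₂ cut)) (subst (λ m → suc c * m * L ≤ T * W) (sym (∣⊤∣≡n n)) cost≤T*W))

    spw-bound : W ^ r * n ^ 1 ≤ b * n ^ r
    spw-bound = begin
      W ^ r * n ^ 1            ≡⟨ cong (W ^ r *_) (*-identityʳ n) ⟩
      W ^ r * n                ≤⟨ *-monoʳ-≤ (W ^ r) n≤b*x^r ⟩
      W ^ r * (b * x ^ r)      ≡⟨ x*[y*z]≡y*[x*z] (W ^ r) b (x ^ r) ⟩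
      b * (W ^ r * x ^ r)      ≡⟨ cong (b *_) (sym (^-distribʳ-* W x r)) ⟩
      b * (W * x) ^ r          ≡⟨ cong (λ y → b * y ^ r) W*x≡x^r ⟩
      b * (x ^ r) ^ r          ≤⟨ *-monoʳ-≤ b (^-monoˡ-≤ r (subst (_≤ n) b^a≡x^r b^a≤n)) ⟩
      b * n ^ r                ∎
      where
      open ≤-Reasoning
      x*[y*z]≡y*[x*z] : ∀ x y z → x * (y * z) ≡ y * (x * z)
      x*[y*z]≡y*[x*z] = solve-∀
      exponents : ∀ q′ → 3 + 4 * q′ + 1 ≡ 4 * suc q′
      exponents = solve-∀
      W*x≡x^r : W * x ≡ x ^ r
      W*x≡x^r = trans (cong (W *_) (sym (*-identityʳ x)))
                  (trans (sym (^-distribˡ-+-* x (3 + 4 * q′) 1)) (cong (x ^_) (exponents q′)))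

  stronglySublinear : StronglySublinear 𝒢 SpwAtMost
  stronglySublinear = b , 1 , r , ≤-refl , s≤s z≤n , b ^ a₀ , λ n b^a₀≤n G G∈𝒢 →
    let (a , b^a≤n , n<b^1+a) = ∃-log b 2≤b n (≤-trans (m^n>0 b a₀) b^a₀≤n)
        a₀≤a = ≮⇒≥ λ a<a₀ → <⇒≱ n<b^1+a (≤-trans (^-monoʳ-≤ b a<a₀) b^a₀≤n)
        open Scale G G∈𝒢 a b^a≤n n<b^1+a a₀≤a
    in W , spw , spw-bound
    where
    instance
      b≢0 : NonZero b
      b≢0 = m^n≢0 2 r
    2≤b : 2 ≤ b
    2≤b = ^-monoʳ-≤ 2 {1} {r} (s≤s z≤n)

star-connected : ∀ s → Connected (Star s)
star-connected s zero    zero    = here ∉⊥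
star-connected s zero    (suc y) = step (here ∉⊥) refl ∉⊥
star-connected s (suc x) zero    = step (here ∉⊥) refl ∉⊥
star-connected s (suc x) (suc y) = step {v = zero} (step (here ∉⊥) refl ∉⊥) refl ∉⊥

-- Every edge of a star meets the centre, so a cycle would visit the centre twice.
star-acyclic : ∀ s → ¬ HasCycle (Star s)
star-acyclic s (x , []     , z , _ , () , _)
star-acyclic s (x , y ∷ ys , z , unique , _ , chain , zx) = acyclic ys unique chain
  where
  triangle : ∀ x y r z → x ≢ r → y ≢ z → starAdj x y ≡ true → starAdj y r ≡ true → starAdj z x ≡ true → ⊥
  triangle zero    (suc _) zero    _       x≢r _   _ _ _ = x≢r refl
  triangle (suc _) zero    _       zero    _   y≢z _ _ _ = y≢z refl
  triangle zero    (suc _) (suc _) _       _   _   _ () _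
  triangle (suc _) zero    _       (suc _) _   _   _ _ ()
  acyclic : ∀ ys → Unique (x ∷ y ∷ ys ++ z ∷ []) → AdjChain (Star s) (x ∷ y ∷ ys ++ z ∷ []) → ⊥
  acyclic []      ((_ ∷ x≢z ∷ []) ∷ (y≢z ∷ []) ∷ _) (cons _ _ _ xy (cons _ _ _ yz _)) =
    triangle x y z z x≢z y≢z xy yz zx
  acyclic (r ∷ rs) ((_ ∷ x≢r ∷ _) ∷ (_ ∷ y≢rs++z) ∷ _) (cons _ _ _ xy (cons _ _ _ yr _)) with ++⁻ʳ rs y≢rs++z
  ... | y≢z ∷ [] = triangle x y r z x≢r y≢z xy yr zx

star-isTree : ∀ s → IsTree (Star s)
star-isTree s = s≤s z≤n , star-connected s , star-acyclic s

spw⇒tpw : ∀ {n} {G : Graph n} {k} → SpwAtMost G k → TpwAtMost G k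
spw⇒tpw (s , φ , partition , width) = suc s , Star s , φ , star-isTree s , partition , width

-- Tree partitions yield balanced separators

module SimplePaths {m} (H : Graph m) where

  open import Data.List.Membership.DecPropositional (Fin._≟_ {m}) using () renaming (_∈?_ to _∈ₗ?_)

  -- Path a w vs: a walk from a to w whose earlier vertices, latest first, are vs
  data Path (a : Fin m) : Fin m → List (Fin m) → Set where
    start : Path a a []
    _▸_   : ∀ {v w vs} → Path a v vs → adj H v w ≡ true → Path a w (v ∷ vs)

  Path-chain : ∀ {a w vs} → Path a w vs → AdjChain H (w ∷ vs)
  Path-chain start                  = one _
  Path-chain (_▸_ {v} {w} {vs} p vw) = cons w v vs (trans (adj-sym H w v) vw) (Path-chain p)

  Path-ends : ∀ {a w vs} → Path a w vs → ∃ λ ys → w ∷ vs ≡ ys ++ a ∷ []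
  Path-ends start = [] , refl
  Path-ends (_▸_ {w = w} p _) with Path-ends p
  ... | ys , eq = w ∷ ys , cong (w ∷_) eq

  Path-truncate : ∀ {a w vs w′} → Path a w vs → w′ ∈ₗ w ∷ vs → Unique (w ∷ vs) →
    ∃ λ vs′ → Path a w′ vs′ × Unique (w′ ∷ vs′) × (∀ {z} → z ∈ₗ w′ ∷ vs′ → z ∈ₗ w ∷ vs)
  Path-truncate p       (here refl)  unique       = _ , p , unique , id
  Path-truncate (p ▸ _) (there w′∈) (_ ∷ unique) with Path-truncate p w′∈ unique
  ... | vs′ , p′ , unique′ , ⊆vs = vs′ , p′ , unique′ , there ∘ ⊆vs

  SimplePath : Subset m → Fin m → Fin m → Set
  SimplePath B a w = ∃ λ vs → Path a w vs × Unique (w ∷ vs) × (∀ {z} → z ∈ₗ w ∷ vs → z ∉ B)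

  -- loop erasure
  simplify : ∀ {B a w} → Reach H B a w → SimplePath B a w
  simplify (here a∉B) = [] , start , [] ∷ [] , λ { (here refl) → a∉B ; (there ()) }
  simplify {w = w} (step r vw w∉B) with simplify r
  ... | vs , p , unique , avoids with w ∈ₗ? _ ∷ vs
  ...   | yes w∈ = let (vs′ , p′ , unique′ , ⊆vs) = Path-truncate p w∈ unique in
                   vs′ , p′ , unique′ , avoids ∘ ⊆vs
  ...   | no  w∉ = _ ∷ vs , p ▸ vw ,
                   All.tabulate (λ z∈ w≡z → w∉ (subst (_∈ₗ _ ∷ vs) (sym w≡z) z∈)) ∷ unique ,
                   λ { (here refl) → w∉B ; (there z∈) → avoids z∈ }

-- Distinct neighbours y, y′ of x in a tree are separated by x, else y′ ⋯ y together with x closes a cycle.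
tree-neighbours-separated : ∀ {m} {H : Graph m} → IsTree H → ∀ {x y y′} →
  adj H x y ≡ true → adj H x y′ ≡ true → y ≢ y′ → ¬ Reach H ⁅ x ⁆ y y′
tree-neighbours-separated {H = H} (_ , _ , acyclic) {x} {y} {y′} xy xy′ y≢y′ r with simplify r
  where open SimplePaths H
... | vs , p , unique , avoids with Path-ends p
  where open SimplePaths H
... | ys , eq = acyclic (x , ys , y , cycle-unique , cycle-long ys eq , cycle-chain , trans (adj-sym H y x) xy)
  where
  open SimplePaths H
  x∉path : All (x ≢_) (y′ ∷ vs)
  x∉path = All.tabulate λ z∈ x≡z → avoids z∈ (subst (_∈ ⁅ x ⁆) x≡z (x∈⁅x⁆ x))
  cycle-unique : Unique (x ∷ ys ++ y ∷ [])
  cycle-unique = subst (λ L → Unique (x ∷ L)) eq (x∉path ∷ unique)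
  cycle-chain : AdjChain H (x ∷ ys ++ y ∷ [])
  cycle-chain = subst (λ L → AdjChain H (x ∷ L)) eq (cons x y′ vs xy′ (Path-chain p))
  cycle-long : ∀ ys → y′ ∷ vs ≡ ys ++ y ∷ [] → 1 ≤ length ys
  cycle-long []      refl = ⊥-elim (y≢y′ refl)
  cycle-long (_ ∷ _) _    = s≤s z≤n

≢⇒∉⁅⁆ : ∀ {n} {x y : Fin n} → x ≢ y → x ∉ ⁅ y ⁆
≢⇒∉⁅⁆ x≢y = x≢y ∘ x∈⁅y⁆⇒x≡y _

module Branches {m} (H : Graph m) (tree : IsTree H) where

  -- the component of H − x containing u (∅ when u = x)
  branch : Fin m → Fin m → Subset m
  branch x u with u ∈? ⁅ x ⁆
  ... | yes _   = ∅
  ... | no  u∉x = proj₁ (component H ⁅ x ⁆ u u∉x)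

  isBranch : ∀ {x u} → u ∉ ⁅ x ⁆ → IsComponent H ⁅ x ⁆ u (branch x u)
  isBranch {x} {u} u∉x with u ∈? ⁅ x ⁆
  ... | yes u∈x  = ⊥-elim (u∉x u∈x)
  ... | no  u∉x′ = proj₂ (component H ⁅ x ⁆ u u∉x′)

  u∈branch : ∀ {x u} → u ∉ ⁅ x ⁆ → u ∈ branch x u
  u∈branch u∉x = ∈-component⁺ (isBranch u∉x) (here u∉x)

  x∉branch : ∀ {x u} → u ∉ ⁅ x ⁆ → x ∉ branch x u
  x∉branch {x} u∉x x∈ = component-avoids (isBranch u∉x) x∈ (x∈⁅x⁆ x)

  ∉branch⇒∉⁅⁆ : ∀ {x y u} → u ∉ ⁅ y ⁆ → x ∉ branch y u → u ∉ ⁅ x ⁆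
  ∉branch⇒∉⁅⁆ {x} u∉y x∉ u∈x = x∉ (subst (_∈ _) (x∈⁅y⁆⇒x≡y x u∈x) (u∈branch u∉y))

  branch-unique : ∀ {x u u′} → u ∉ ⁅ x ⁆ → u′ ∈ branch x u → branch x u′ ≡ branch x u
  branch-unique u∉x u′∈ = component-unique (isBranch (component-avoids (isBranch u∉x) u′∈)) (isBranch u∉x)
    (Reach-sym (∈-component⁻ (isBranch u∉x) u′∈))

  branches-disjoint : ∀ {x u u′ w} → u ∉ ⁅ x ⁆ → u′ ∉ ⁅ x ⁆ → u′ ∉ branch x u →
    w ∈ branch x u → w ∉ branch x u′
  branches-disjoint u∉x u′∉x u′∉ w∈ w∈′ = u′∉ (∈-component⁺ (isBranch u∉x)
    (Reach-trans (∈-component⁻ (isBranch u∉x) w∈) (Reach-sym (∈-component⁻ (isBranch u′∉x) w∈′))))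

  exit-neighbour : ∀ {B x u w} → u ∉ ⁅ x ⁆ → w ∈ branch x u → Reach H B x w →
    ∃ λ y → adj H x y ≡ true × y ∈ branch x u × y ∉ B
  exit-neighbour u∉x w∈ (here _) = ⊥-elim (x∉branch u∉x w∈)
  exit-neighbour {x = x} u∉x w∈ (step {v = v} {w} r vw w∉B) with v Fin.≟ x
  ... | yes refl = w , vw , w∈ , w∉B
  ... | no  v≢x  = exit-neighbour u∉x
    (component-closed (isBranch u∉x) w∈ (trans (adj-sym H w v) vw) (≢⇒∉⁅⁆ v≢x)) r

  neighbour-in-branch : ∀ {x u} → u ∉ ⁅ x ⁆ → ∃ λ y → adj H x y ≡ true × y ∈ branch x u
  neighbour-in-branch {x} {u} u∉x with exit-neighbour u∉x (u∈branch u∉x) (proj₁ (proj₂ tree) x u)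
  ... | y , xy , y∈ , _ = y , xy , y∈

  -- A branch at y containing x misses the branch at x containing y: a common vertex would give
  -- x a second neighbour in that branch.
  branch-behind : ∀ {x y u u′ w} → u ∉ ⁅ x ⁆ → u′ ∉ ⁅ y ⁆ → adj H x y ≡ true →
    y ∈ branch x u → x ∈ branch y u′ → w ∈ branch x u → w ∉ branch y u′
  branch-behind {x} {y} u∉x u′∉y xy y∈ x∈′ w∈ w∈′
    with exit-neighbour u∉x w∈ (Reach-trans (Reach-sym (∈-component⁻ (isBranch u′∉y) x∈′))
                                             (∈-component⁻ (isBranch u′∉y) w∈′))
  ... | y′ , xy′ , y′∈ , y′∉y =
    tree-neighbours-separated tree xy xy′ (λ y≡y′ → y′∉y (subst (_∈ ⁅ y ⁆) y≡y′ (x∈⁅x⁆ y)))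
    (Reach-trans (Reach-sym (∈-component⁻ (isBranch u∉x) y∈)) (∈-component⁻ (isBranch u∉x) y′∈))

  branch-ahead : ∀ {x y u′} → u′ ∉ ⁅ y ⁆ → x ∉ branch y u′ → branch y u′ ⊆ branch x u′
  branch-ahead {x} {y} {u′} u′∉y x∉ w∈ = ∈-component⁺ (isBranch (∉branch⇒∉⁅⁆ u′∉y x∉))
    (proj₁ (Reach-within (component-closed (isBranch u′∉y)) avoid (u∈branch u′∉y)
                         (∈-component⁻ (isBranch u′∉y) w∈)))
    where
    avoid : ∀ {z} → z ∈ branch y u′ → z ∉ ⁅ y ⁆ → z ∉ ⁅ x ⁆
    avoid z∈ _ z∈x = x∉ (subst (_∈ _) (x∈⁅y⁆⇒x≡y x z∈x) z∈)

module TreePartition {n m} (G : Graph n) (H : Graph m) (φ : Fin n → Fin m)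
  (tree : IsTree H) (partition : IsHPartition H G φ) where

  open Branches H tree

  preimage : Subset m → Subset n
  preimage Y = tabulate (λ v → lookup Y (φ v))

  ∈-preimage⁺ : ∀ {Y v} → φ v ∈ Y → v ∈ preimage Y
  ∈-preimage⁺ {Y} {v} φv∈Y = lookup⇒[]= v _ (trans (lookup∘tabulate _ v) ([]=⇒lookup φv∈Y))

  ∈-preimage⁻ : ∀ {Y v} → v ∈ preimage Y → φ v ∈ Y
  ∈-preimage⁻ {Y} {v} v∈ = lookup⇒[]= (φ v) Y (trans (sym (lookup∘tabulate _ v)) ([]=⇒lookup v∈))

  Heavy : Subset m → Set
  Heavy Y = n < 2 * ∣ preimage Y ∣

  heavy-mono : ∀ {Y Z} → Y ⊆ Z → Heavy Y → Heavy Z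
  heavy-mono Y⊆Z heavy = <-≤-trans heavy (*-monoʳ-≤ 2 (p⊆q⇒∣p∣≤∣q∣ (∈-preimage⁺ ∘ Y⊆Z ∘ ∈-preimage⁻)))

  heavy-disjoint : ∀ {Y Z} → Heavy Y → Heavy Z → (∀ {w} → w ∈ Y → w ∉ Z) → ⊥
  heavy-disjoint {Y} {Z} heavyY heavyZ disjoint = <-irrefl refl (begin-strict
    n + n                                     <⟨ +-mono-< heavyY heavyZ ⟩
    2 * ∣ preimage Y ∣ + 2 * ∣ preimage Z ∣   ≡⟨ sym (*-distribˡ-+ 2 ∣ preimage Y ∣ ∣ preimage Z ∣) ⟩
    2 * (∣ preimage Y ∣ + ∣ preimage Z ∣)     ≤⟨ *-monoʳ-≤ 2 (∣p∣+∣q∣≤n (preimage Y) (preimage Z)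
                                                   λ v∈Y v∈Z → disjoint (∈-preimage⁻ v∈Y) (∈-preimage⁻ v∈Z)) ⟩
    2 * n                                     ≡⟨ cong (n +_) (+-identityʳ n) ⟩
    n + n                                     ∎)
    where open ≤-Reasoning

  Good : Fin m → Set
  Good x = ∀ u → u ∉ ⁅ x ⁆ → 2 * ∣ preimage (branch x u) ∣ ≤ n

  good? : ∀ x → Good x ⊎ ∃ λ u → u ∉ ⁅ x ⁆ × Heavy (branch x u)
  good? x with any? (λ u → ¬? (u ∈? ⁅ x ⁆) ×-dec (n <? 2 * ∣ preimage (branch x u) ∣))
  ... | yes heavy = inj₂ heavy
  ... | no  ¬heavy = inj₁ λ u u∉x → ≮⇒≥ λ heavy → ¬heavy (u , u∉x , heavy)

  -- Step from x into its heavy branch; the heavy branch at the new node lies strictly inside the old one.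
  descend : ∀ {x u} → Acc _⊂_ (branch x u) → u ∉ ⁅ x ⁆ → Heavy (branch x u) → ∃ Good
  descend {x} {u} (acc rs) u∉x heavy with neighbour-in-branch u∉x
  ... | y , xy , y∈ with good? y
  ... | inj₁ good = y , good
  ... | inj₂ (u′ , u′∉y , heavy′) with x ∈? branch y u′
  ...   | yes x∈′ = ⊥-elim (heavy-disjoint heavy heavy′ (branch-behind u∉x u′∉y xy y∈ x∈′))
  ...   | no  x∉′ with u′ ∈? branch x u
  ...     | yes u′∈ = descend (rs (subst (branch y u′ ⊆_) (branch-unique u∉x u′∈) (branch-ahead u′∉y x∉′) ,
                                       y , y∈ , x∉branch u′∉y)) u′∉y heavy′
  ...     | no  u′∉ = ⊥-elim (heavy-disjoint heavy (heavy-mono (branch-ahead u′∉y x∉′) heavy′)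
                                 (branches-disjoint u∉x (∉branch⇒∉⁅⁆ u′∉y x∉′) u′∉))

  good : ∃ Good
  good with good? (Fin.fromℕ< (proj₁ tree))
  ... | inj₁ g = _ , g
  ... | inj₂ (u , u∉x , heavy) = descend (⊂-wellFounded _) u∉x heavy

  Reach-image : ∀ {x v w} → Reach G (part φ x) v w → Reach H ⁅ x ⁆ (φ v) (φ w)
  Reach-image (here v∉) = here (v∉ ∘ ∈-part⁺ φ ∘ x∈⁅y⁆⇒x≡y _)
  Reach-image {x} (step r vw w∉) with partition _ _ vw
  ... | inj₁ φv≡φw = subst (Reach H ⁅ x ⁆ _) φv≡φw (Reach-image r)
  ... | inj₂ φvφw  = step (Reach-image r) φvφw (w∉ ∘ ∈-part⁺ φ ∘ x∈⁅y⁆⇒x≡y _)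

  good⇒balanced : ∀ {x} → Good x → BalancedSeparator G (part φ x)
  good⇒balanced {x} good v v∉ C isC = ≤-trans (*-monoʳ-≤ 2 (p⊆q⇒∣p∣≤∣q∣ C⊆)) (good (φ v) φv∉x)
    where
    φv∉x : φ v ∉ ⁅ x ⁆
    φv∉x = v∉ ∘ ∈-part⁺ φ ∘ x∈⁅y⁆⇒x≡y _
    C⊆ : C ⊆ preimage (branch x (φ v))
    C⊆ w∈C = ∈-preimage⁺ (∈-component⁺ (isBranch φv∉x) (Reach-image (∈-component⁻ isC w∈C)))

tpw⇒sep : ∀ {n} {G : Graph n} {k} → TpwAtMost G k → SepAtMost G k
tpw⇒sep {G = G} (m , H , φ , tree , partition , width) =
  part φ x , good⇒balanced goodx , width x
  where
  open TreePartition G H φ tree partition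
  x : Fin m
  x = proj₁ good
  goodx : Good x
  goodx = proj₂ good

theorem3 : (𝒢 : GraphClass) → Hereditary 𝒢 →
    (StronglySublinear 𝒢 SepAtMost ⇔ StronglySublinear 𝒢 TpwAtMost) ×
    (StronglySublinear 𝒢 TpwAtMost ⇔ StronglySublinear 𝒢 SpwAtMost)
theorem3 𝒢 hereditary =
  mk⇔ (spw→tpw ∘ sep→spw) tpw→sep , mk⇔ (sep→spw ∘ tpw→sep) spw→tpw
  where
  sep→spw : StronglySublinear 𝒢 SepAtMost → StronglySublinear 𝒢 SpwAtMost
  sep→spw (_ , _ , zero , _ , () , _)
  sep→spw (c , p , suc q′ , 1≤p , _ , N , bounded) =
    SeparatorsToStars.stronglySublinear 𝒢 hereditary c p q′ N 1≤p bounded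
  spw→tpw : StronglySublinear 𝒢 SpwAtMost → StronglySublinear 𝒢 TpwAtMost
  spw→tpw = StronglySublinear-map (λ {n} {G} {k} → spw⇒tpw {n} {G} {k})
  tpw→sep : StronglySublinear 𝒢 TpwAtMost → StronglySublinear 𝒢 SepAtMost
  tpw→sep = StronglySublinear-map (λ {n} {G} {k} → tpw⇒sep {n} {G} {k})
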